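{- In the DSC$(2)$ process, let $D^{(0)}(k,n)$ be the number of vertices of degree $k$ in the $1$-skeleton of $\mathcal{K}(n)$, and $N_0(n),N_1(n)$ the numbers of vertices and edges of $\mathcal{K}(n)$. Then for $n\ge2$ and all $k\ge1$, $$D^{(0)}(k,n)=N_0(n-1)\,\delta_{k,1}+N_1(n-1)\,\delta_{k,2}+\mathbf{1}[k\ge3,\ k\text{ odd}]\,D^{(0)}\!\left(\tfrac{k-1}{2},n-1\right).$$ Consequently, for $n\ge1$ the set of distinct vertex degrees occurring in $\mathcal{K}(n)$ is $\{k_1<k_2<\dots<k_{2n-1}\}$, where $k_i=2^{(i+1)/2}-1$ for odd $i$ and $k_i=3\cdot2^{i/2-1}-1$ for even $i$.
   Context: The DSC$(2)$ process: $\mathcal{K}(0)$ consists of a single vertex. For $n\ge1$, $\mathcal{K}(n)$ is obtained from $\mathcal{K}(n-1)$ by adding, for every vertex and every edge $\sigma$ of $\mathcal{K}(n-1)$, a new vertex $w_\sigma$ together with the simplex $\sigma\cup\{w_\sigma\}$ and all its faces (distinct simplices receive distinct new vertices); triangles receive nothing. $\delta$ is the Kronecker delta. -}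

module Defs where

open import Data.Nat using (ℕ; zero; suc; _+_; _*_; _∸_; _^_; _≡ᵇ_; _≤ᵇ_; _/_; _%_)
open import Data.Bool using (Bool; true; false; if_then_else_; _∨_; _∧_)
open import Data.List using (List; []; _∷_; _++_; map; length; concat; upTo)
open import Data.Product using (_×_; _,_)

-- A finite simplicial complex of dimension ≤ 2 with vertex set {0,…,nV-1},
-- edges listed as unordered pairs (a , b) with a ≠ b, triangles as triples.
record Complex : Set where
  constructor mkComplex
  field
    nV        : ℕ
    edges     : List (ℕ × ℕ)
    triangles : List (ℕ × ℕ × ℕ)
open Complex public

count : {A : Set} → (A → Bool) → List A → ℕ
count p []       = 0
count p (x ∷ xs) = if p x then suc (count p xs) else count p xs

indexed : {A : Set} → ℕ → List A → List (ℕ × A)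
indexed i []       = []
indexed i (x ∷ xs) = (i , x) ∷ indexed (suc i) xs

-- New vertex for old vertex v : label nV + v, with edge {v, nV+v}.
-- New vertex for the j-th edge {a,b} : label 2·nV + j, with edges {a,w},{b,w}
-- and triangle {a,b,w}.  Triangles receive nothing.
step : Complex → Complex
step (mkComplex n es ts) =
  mkComplex (n + n + length es)
    (es ++ map (λ v → (v , n + v)) (upTo n)
        ++ concat (map (λ { (j , (a , b)) → (a , n + n + j) ∷ (b , n + n + j) ∷ [] })
                       (indexed 0 es)))
    (ts ++ map (λ { (j , (a , b)) → (a , b , n + n + j) }) (indexed 0 es))

K : ℕ → Complex
K zero    = mkComplex 1 [] []
K (suc n) = step (K n)

deg : Complex → ℕ → ℕ
deg C v = count (λ { (a , b) → (v ≡ᵇ a) ∨ (v ≡ᵇ b) }) (edges C)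

N0 : ℕ → ℕ
N0 n = nV (K n)

N1 : ℕ → ℕ
N1 n = length (edges (K n))

D0 : ℕ → ℕ → ℕ
D0 k n = count (λ v → deg (K n) v ≡ᵇ k) (upTo (N0 n))

δ : ℕ → ℕ → ℕ
δ i j = if i ≡ᵇ j then 1 else 0

oddInd : ℕ → ℕ
oddInd k = if (3 ≤ᵇ k) ∧ (k % 2 ≡ᵇ 1) then 1 else 0

kseq : ℕ → ℕ
kseq i = if i % 2 ≡ᵇ 1 then 2 ^ ((i + 1) / 2) ∸ 1 else 3 * 2 ^ (i / 2 ∸ 1) ∸ 1

-- In one step an old vertex of degree d keeps its d edges and gains its pendant edge and one
-- edge to the apex of each of its d edges, so its degree becomes 2d + 1; pendant vertices have
-- degree 1 and apices degree 2.  Counting the three blocks of vertices separately gives the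
-- recursion, the odd block needing d ≥ 1, i.e. no isolated vertex, which holds from K(1) on.
-- Since k_(i+2) = 2 k_i + 1 with k_1 = 1 and k_2 = 2, the map d ↦ 2d + 1 shifts the degree set
-- of K(n) onto {k_3, …, k_(2n+1)}, and the new vertices contribute k_1 and k_2.
module Submission where

open import Defs
open import Data.Nat using (ℕ; _+_; _*_; _∸_; _/_; _≤_; _<_)
open import Data.Product using (_×_; Σ; _,_)
open import Relation.Binary.PropositionalEquality using (_≡_)

open import Data.Nat.Base using (zero; suc; _≡ᵇ_; _≤ᵇ_; _%_; _^_; z≤n; s≤s; s≤s⁻¹; z<s; s<s)
open import Data.Nat.Properties
open import Data.Nat.DivMod using (m*n/n≡m; m*n%n≡0; [m+kn]%n≡m%n)
open import Data.Nat.Tactic.RingSolver using (solve-∀)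
open import Data.Bool.Base using (Bool; true; false; if_then_else_; _∨_; _∧_; T)
open import Data.Bool.Properties using (∧-zeroʳ)
open import Data.Empty using (⊥; ⊥-elim)
open import Data.Sum.Base using (_⊎_; inj₁; inj₂)
open import Data.List.Base using (List; []; _∷_; _++_; map; length; concat; upTo; applyUpTo)
open import Data.List.Properties using (length-++; length-map; length-upTo)
open import Data.List.Relation.Unary.All as All using (All; []; _∷_)
open import Data.List.Relation.Unary.All.Properties using (++⁺; map⁺; applyUpTo⁺₁)
open import Function.Base using (_∘_; id)
open import Relation.Binary.PropositionalEquality
  using (refl; sym; trans; cong; cong₂; subst; subst₂; _≢_; ≢-sym; module ≡-Reasoning)
open import Relation.Nullary using (yes; no)

open ≡-Reasoning

indicator : Bool → ℕ
indicator b = if b then 1 else 0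

indicator-∨ : ∀ x y → (T x → T y → ⊥) → indicator (x ∨ y) ≡ indicator x + indicator y
indicator-∨ true  true  disjoint = ⊥-elim (disjoint _ _)
indicator-∨ true  false _        = refl
indicator-∨ false y     _        = refl

δ-≡ : ∀ {a b} → a ≡ b → δ a b ≡ 1
δ-≡ {zero}  refl = refl
δ-≡ {suc a} refl = δ-≡ {a} refl

δ-≢ : ∀ {a b} → a ≢ b → δ a b ≡ 0
δ-≢ {zero}  {zero}  a≢b = ⊥-elim (a≢b refl)
δ-≢ {zero}  {suc b} _   = refl
δ-≢ {suc a} {zero}  _   = refl
δ-≢ {suc a} {suc b} a≢b = δ-≢ (a≢b ∘ cong suc)

δ-cong : ∀ {a b c d} → (a ≡ b → c ≡ d) → (c ≡ d → a ≡ b) → δ a b ≡ δ c d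
δ-cong {a} {b} to from with a ≟ b
... | yes a≡b = trans (δ-≡ a≡b) (sym (δ-≡ (to a≡b)))
... | no  a≢b = trans (δ-≢ a≢b) (sym (δ-≢ (a≢b ∘ from)))

δ-sym : ∀ a b → δ a b ≡ δ b a
δ-sym a b = δ-cong {a} {b} sym sym

count-cons : {A : Set} (p : A → Bool) (x : A) (xs : List A) →
             count p (x ∷ xs) ≡ indicator (p x) + count p xs
count-cons p x xs with p x
... | true  = refl
... | false = refl

count-++ : {A : Set} (p : A → Bool) (xs ys : List A) →
           count p (xs ++ ys) ≡ count p xs + count p ys
count-++ p []       ys = refl
count-++ p (x ∷ xs) ys = begin
  count p (x ∷ xs ++ ys)                   ≡⟨ count-cons p x (xs ++ ys) ⟩
  indicator (p x) + count p (xs ++ ys)     ≡⟨ cong (indicator (p x) +_) (count-++ p xs ys) ⟩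
  indicator (p x) + (count p xs + count p ys) ≡⟨ +-assoc (indicator (p x)) _ _ ⟨
  indicator (p x) + count p xs + count p ys ≡⟨ cong (_+ count p ys) (count-cons p x xs) ⟨
  count p (x ∷ xs) + count p ys            ∎

count-map : {A B : Set} (p : B → Bool) (f : A → B) (xs : List A) →
            count p (map f xs) ≡ count (p ∘ f) xs
count-map p f []       = refl
count-map p f (x ∷ xs) with p (f x)
... | true  = cong suc (count-map p f xs)
... | false = count-map p f xs

sumBelow : ℕ → (ℕ → ℕ) → ℕ
sumBelow zero    f = 0
sumBelow (suc n) f = f 0 + sumBelow n (f ∘ suc)

count-applyUpTo : (p : ℕ → Bool) (f : ℕ → ℕ) (n : ℕ) →
                  count p (applyUpTo f n) ≡ sumBelow n (indicator ∘ p ∘ f)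
count-applyUpTo p f zero    = refl
count-applyUpTo p f (suc n) =
  trans (count-cons p (f 0) (applyUpTo (f ∘ suc) n))
        (cong (indicator (p (f 0)) +_) (count-applyUpTo p (f ∘ suc) n))

count-upTo : (p : ℕ → Bool) (n : ℕ) → count p (upTo n) ≡ sumBelow n (indicator ∘ p)
count-upTo p = count-applyUpTo p id

sumBelow-+ : ∀ m n f → sumBelow (m + n) f ≡ sumBelow m f + sumBelow n (λ i → f (m + i))
sumBelow-+ zero    n f = refl
sumBelow-+ (suc m) n f =
  trans (cong (f 0 +_) (sumBelow-+ m n (f ∘ suc))) (sym (+-assoc (f 0) _ _))

sumBelow-cong : ∀ n {f g} → (∀ {i} → i < n → f i ≡ g i) → sumBelow n f ≡ sumBelow n g
sumBelow-cong zero    eq = refl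
sumBelow-cong (suc n) eq = cong₂ _+_ (eq z<s) (sumBelow-cong n (eq ∘ s<s))

sumBelow-const : ∀ n c → sumBelow n (λ _ → c) ≡ n * c
sumBelow-const zero    c = refl
sumBelow-const (suc n) c = cong (c +_) (sumBelow-const n c)

sumBelow-*ˡ : ∀ n c f → sumBelow n (λ i → c * f i) ≡ c * sumBelow n f
sumBelow-*ˡ zero    c f = sym (*-zeroʳ c)
sumBelow-*ˡ (suc n) c f =
  trans (cong (c * f 0 +_) (sumBelow-*ˡ n c (f ∘ suc))) (sym (*-distribˡ-+ c (f 0) _))

sumBelow-+-distrib : ∀ n f g → sumBelow n (λ i → f i + g i) ≡ sumBelow n f + sumBelow n g
sumBelow-+-distrib zero    f g = refl
sumBelow-+-distrib (suc n) f g =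
  trans (cong (f 0 + g 0 +_) (sumBelow-+-distrib n (f ∘ suc) (g ∘ suc)))
        (interchange (f 0) (g 0) _ _)
  where
  interchange : ∀ a b c d → a + b + (c + d) ≡ a + c + (b + d)
  interchange = solve-∀

sumBelow-δ-hit : ∀ c {u l} → u < l → sumBelow l (λ i → δ (c + u) (c + i)) ≡ 1
sumBelow-δ-hit (suc c)  u<l = sumBelow-δ-hit c u<l
sumBelow-δ-hit zero {zero}  {suc l} _ = cong suc (trans (sumBelow-const l 0) (*-zeroʳ l))
sumBelow-δ-hit zero {suc u} {suc l} (s<s u<l) = sumBelow-δ-hit zero u<l

sumBelow-δ-miss : ∀ l v (f : ℕ → ℕ) → (∀ {i} → i < l → v ≢ f i) → sumBelow l (λ i → δ v (f i)) ≡ 0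
sumBelow-δ-miss l v f miss =
  trans (sumBelow-cong l (λ i<l → δ-≢ (miss i<l))) (trans (sumBelow-const l 0) (*-zeroʳ l))

-- Degrees in one step of the process

-- deg C v is definitionally count (incident v) (edges C), and δ a b is indicator (a ≡ᵇ b).
incident : ℕ → ℕ × ℕ → Bool
incident v (a , b) = (v ≡ᵇ a) ∨ (v ≡ᵇ b)

indicator-incident : ∀ v {a b} → a ≢ b → indicator (incident v (a , b)) ≡ δ v a + δ v b
indicator-incident v {a} {b} a≢b = indicator-∨ (v ≡ᵇ a) (v ≡ᵇ b)
  (λ v≡a v≡b → a≢b (trans (sym (≡ᵇ⇒≡ v a v≡a)) (≡ᵇ⇒≡ v b v≡b)))

EdgeBelow : ℕ → ℕ × ℕ → Set
EdgeBelow n (a , b) = a < b × b < n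

WellFormed : Complex → Set
WellFormed C = All (EdgeBelow (nV C)) (edges C)

apexEdges : ℕ → ℕ × (ℕ × ℕ) → List (ℕ × ℕ)
apexEdges n (j , (a , b)) = (a , n + n + j) ∷ (b , n + n + j) ∷ []

count-incident-outside : ∀ {n v} → n ≤ v → ∀ es → All (EdgeBelow n) es → count (incident v) es ≡ 0
count-incident-outside n≤v []             []                   = refl
count-incident-outside {n} {v} n≤v ((a , b) ∷ es) ((a<b , b<n) ∷ below) =
  trans (count-cons (incident v) (a , b) es)
        (cong₂ _+_ (trans (indicator-incident v (<⇒≢ a<b))
                          (cong₂ _+_ (δ-≢ (outside (<-trans a<b b<n))) (δ-≢ (outside b<n))))
                   (count-incident-outside n≤v es below))
  where
  outside : ∀ {x} → x < n → v ≢ x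
  outside x<n v≡x = <⇒≢ (<-≤-trans x<n n≤v) (sym v≡x)

count-incident-pendant : ∀ n v →
  count (incident v) (map (λ u → (u , n + u)) (upTo n))
    ≡ sumBelow n (δ v) + sumBelow n (λ u → δ v (n + u))
count-incident-pendant n v = begin
  count (incident v) (map (λ u → (u , n + u)) (upTo n))
    ≡⟨ count-map (incident v) _ (upTo n) ⟩
  count (λ u → incident v (u , n + u)) (upTo n)
    ≡⟨ count-upTo _ n ⟩
  sumBelow n (λ u → indicator (incident v (u , n + u)))
    ≡⟨ sumBelow-cong n (λ u<n → indicator-incident v (<⇒≢ (<-≤-trans u<n (m≤m+n n _)))) ⟩
  sumBelow n (λ u → δ v u + δ v (n + u))
    ≡⟨ sumBelow-+-distrib n (δ v) _ ⟩
  sumBelow n (δ v) + sumBelow n (λ u → δ v (n + u)) ∎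

count-incident-apex : ∀ {n} v i es → All (EdgeBelow n) es →
  count (incident v) (concat (map (apexEdges n) (indexed i es)))
    ≡ count (incident v) es + 2 * sumBelow (length es) (λ j → δ v (n + n + (i + j)))
count-incident-apex v i [] [] = refl
count-incident-apex {n} v i ((a , b) ∷ es) ((a<b , b<n) ∷ below) = begin
  count (incident v) ((a , w) ∷ (b , w) ∷ rest)
    ≡⟨ trans (count-cons (incident v) (a , w) ((b , w) ∷ rest)) (cong (indicator (incident v (a , w)) +_) (count-cons (incident v) (b , w) rest)) ⟩
  indicator (incident v (a , w)) + (indicator (incident v (b , w)) + count (incident v) rest)
    ≡⟨ cong₂ (λ x y → x + (y + count (incident v) rest))
             (indicator-incident v (apart (<-trans a<b b<n))) (indicator-incident v (apart b<n)) ⟩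
  (δ v a + δ v w) + ((δ v b + δ v w) + count (incident v) rest)
    ≡⟨ cong (λ x → (δ v a + δ v w) + ((δ v b + δ v w) + x)) (count-incident-apex v (suc i) es below) ⟩
  (δ v a + δ v w) + ((δ v b + δ v w) + (count (incident v) es + 2 * later))
    ≡⟨ regroup (δ v a) (δ v b) (δ v w) _ later ⟩
  (δ v a + δ v b) + count (incident v) es + 2 * (δ v w + later)
    ≡⟨ cong₂ (λ x y → (δ v a + δ v b) + count (incident v) es + 2 * (δ v (n + n + x) + y))
             (+-identityʳ i) (sumBelow-cong (length es) (λ {j} _ → cong (λ x → δ v (n + n + x)) (+-suc i j))) ⟨
  (δ v a + δ v b) + count (incident v) es + 2 * sumBelow (suc (length es)) (λ j → δ v (n + n + (i + j)))
    ≡⟨ cong (λ x → x + count (incident v) es + _) (indicator-incident v (<⇒≢ a<b)) ⟨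
  indicator (incident v (a , b)) + count (incident v) es + _
    ≡⟨ cong (_+ _) (count-cons (incident v) (a , b) es) ⟨
  count (incident v) ((a , b) ∷ es) + 2 * sumBelow (suc (length es)) (λ j → δ v (n + n + (i + j))) ∎
  where
  w = n + n + i
  rest = concat (map (apexEdges n) (indexed (suc i) es))
  later = sumBelow (length es) (λ j → δ v (n + n + (suc i + j)))
  apart : ∀ {x} → x < n → x ≢ w
  apart x<n = <⇒≢ (<-≤-trans x<n (≤-trans (m≤m+n n n) (m≤m+n (n + n) i)))
  regroup : ∀ a b c d e → (a + c) + ((b + c) + (d + 2 * e)) ≡ (a + b) + d + 2 * (c + e)
  regroup = solve-∀

deg-step : ∀ C → WellFormed C → ∀ v →
  deg (step C) v ≡ 2 * deg C v + (sumBelow (nV C) (δ v) + sumBelow (nV C) (λ u → δ v (nV C + u))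
                                  + 2 * sumBelow (length (edges C)) (λ j → δ v (nV C + nV C + j)))
deg-step C wf v = begin
  deg (step C) v
    ≡⟨ count-++ (incident v) (edges C) _ ⟩
  d + count (incident v) (pendantEdges ++ apexEdgeList)
    ≡⟨ cong (d +_) (count-++ (incident v) pendantEdges apexEdgeList) ⟩
  d + (count (incident v) pendantEdges + count (incident v) apexEdgeList)
    ≡⟨ cong₂ (λ x y → d + (x + y)) (count-incident-pendant n v) (count-incident-apex v 0 (edges C) wf) ⟩
  d + ((P + Q) + (d + 2 * R))
    ≡⟨ regroup d (P + Q) R ⟩
  2 * d + (P + Q + 2 * R) ∎
  where
  n = nV C
  d = deg C v
  pendantEdges = map (λ u → (u , n + u)) (upTo n)
  apexEdgeList = concat (map (apexEdges n) (indexed 0 (edges C)))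
  P = sumBelow n (δ v)
  Q = sumBelow n (λ u → δ v (n + u))
  R = sumBelow (length (edges C)) (λ j → δ v (n + n + j))
  regroup : ∀ a b c → a + (b + (a + 2 * c)) ≡ 2 * a + (b + 2 * c)
  regroup = solve-∀

module _ (C : Complex) (wf : WellFormed C) where
  private
    n = nV C
    m = length (edges C)

  deg-step-old : ∀ {v} → v < n → deg (step C) v ≡ suc (2 * deg C v)
  deg-step-old {v} v<n = begin
    deg (step C) v ≡⟨ deg-step C wf v ⟩
    2 * deg C v + (sumBelow n (δ v) + sumBelow n (λ u → δ v (n + u))
                   + 2 * sumBelow m (λ j → δ v (n + n + j)))
      ≡⟨ cong (2 * deg C v +_) (cong₂ _+_
           (cong₂ _+_ (sumBelow-δ-hit 0 v<n) (sumBelow-δ-miss n v (n +_) (λ {i} _ → beyond (m≤m+n n i))))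
           (cong (2 *_) (sumBelow-δ-miss m v (n + n +_) (λ {j} _ → beyond (≤-trans (m≤m+n n n) (m≤m+n (n + n) j)))))) ⟩
    2 * deg C v + 1 ≡⟨ +-comm _ 1 ⟩
    suc (2 * deg C v) ∎
    where
    beyond : ∀ {x} → n ≤ x → v ≢ x
    beyond n≤x = <⇒≢ (<-≤-trans v<n n≤x)

  deg-step-pendant : ∀ {u} → u < n → deg (step C) (n + u) ≡ 1
  deg-step-pendant {u} u<n = begin
    deg (step C) (n + u) ≡⟨ deg-step C wf (n + u) ⟩
    2 * deg C (n + u) + (sumBelow n (δ (n + u)) + sumBelow n (λ i → δ (n + u) (n + i))
                         + 2 * sumBelow m (λ j → δ (n + u) (n + n + j)))
      ≡⟨ cong₂ _+_ (cong (2 *_) (count-incident-outside (m≤m+n n u) (edges C) wf)) (cong₂ _+_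
           (cong₂ _+_ (sumBelow-δ-miss n (n + u) id (λ {i} i<n → ≢-sym (<⇒≢ {i} (<-≤-trans i<n (m≤m+n n u)))))
                      (sumBelow-δ-hit n u<n))
           (cong (2 *_) (sumBelow-δ-miss m (n + u) (n + n +_)
              (λ {j} _ → <⇒≢ (<-≤-trans (+-monoʳ-< n u<n) (m≤m+n (n + n) j)))))) ⟩
    1 ∎

  deg-step-apex : ∀ {j} → j < m → deg (step C) (n + n + j) ≡ 2
  deg-step-apex {j} j<m = begin
    deg (step C) v ≡⟨ deg-step C wf v ⟩
    2 * deg C v + (sumBelow n (δ v) + sumBelow n (λ u → δ v (n + u))
                   + 2 * sumBelow m (λ i → δ v (n + n + i)))
      ≡⟨ cong₂ _+_ (cong (2 *_) (count-incident-outside n≤v (edges C) wf)) (cong₂ _+_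
           (cong₂ _+_ (sumBelow-δ-miss n v id (λ {u} u<n → ≢-sym (<⇒≢ {u} (<-≤-trans u<n n≤v))))
                      (sumBelow-δ-miss n v (n +_)
                         (λ {u} u<n → ≢-sym (<⇒≢ {n + u} (<-≤-trans (+-monoʳ-< n u<n) (m≤m+n (n + n) j))))))
           (cong (2 *_) (sumBelow-δ-hit (n + n) j<m))) ⟩
    2 ∎
    where
    v = n + n + j
    n≤v = ≤-trans (m≤m+n n n) (m≤m+n (n + n) j)

EdgeBelow-≤ : ∀ {n n′} → n ≤ n′ → ∀ {e} → EdgeBelow n e → EdgeBelow n′ e
EdgeBelow-≤ n≤n′ (a<b , b<n) = a<b , <-≤-trans b<n n≤n′

apexEdges-below : ∀ n m i es → All (EdgeBelow n) es → i + length es ≤ m →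
                  All (EdgeBelow (n + n + m)) (concat (map (apexEdges n) (indexed i es)))
apexEdges-below n m i []             []                   _   = []
apexEdges-below n m i ((a , b) ∷ es) ((a<b , b<n) ∷ below) i+l≤m =
  (<-≤-trans (<-trans a<b b<n) n≤apex , apex<) ∷ (<-≤-trans b<n n≤apex , apex<)
  ∷ apexEdges-below n m (suc i) es below (subst (_≤ m) (+-suc i (length es)) i+l≤m)
  where
  n≤apex = ≤-trans (m≤m+n n n) (m≤m+n (n + n) i)
  apex< = +-monoʳ-< (n + n) (<-≤-trans (m<m+n i z<s) i+l≤m)

step-wellFormed : ∀ C → WellFormed C → WellFormed (step C)
step-wellFormed C wf =
  ++⁺ (All.map (EdgeBelow-≤ (≤-trans (m≤m+n n n) (m≤m+n (n + n) m))) wf)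
      (++⁺ (map⁺ (applyUpTo⁺₁ id n pendant-below))
           (apexEdges-below n m 0 (edges C) wf ≤-refl))
  where
  n = nV C
  m = length (edges C)
  pendant-below : ∀ {u} → u < n → EdgeBelow (n + n + m) (u , n + u)
  pendant-below {u} u<n =
    <-≤-trans u<n (m≤m+n n u) , <-≤-trans (+-monoʳ-< n u<n) (m≤m+n (n + n) m)

K-wellFormed : ∀ n → WellFormed (K n)
K-wellFormed zero    = []
K-wellFormed (suc n) = step-wellFormed (K n) (K-wellFormed n)

data StepVertex (n m : ℕ) : ℕ → Set where
  old     : ∀ {v} → v < n → StepVertex n m v
  pendant : ∀ {u} → u < n → StepVertex n m (n + u)
  apex    : ∀ {j} → j < m → StepVertex n m (n + n + j)

<-+-split : ∀ a b {v} → v < a + b → v < a ⊎ Σ ℕ λ u → v ≡ a + u × u < b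
<-+-split a b {v} v<a+b with v <? a
... | yes v<a = inj₁ v<a
... | no  v≮a = inj₂ (v ∸ a , sym a+[v∸a]≡v ,
                      +-cancelˡ-< a (v ∸ a) b (subst (_< a + b) (sym a+[v∸a]≡v) v<a+b))
  where a+[v∸a]≡v = m+[n∸m]≡n (≮⇒≥ v≮a)

stepVertex : ∀ n m {v} → v < n + n + m → StepVertex n m v
stepVertex n m v<nnm with <-+-split (n + n) m v<nnm
... | inj₂ (j , refl , j<m) = apex j<m
... | inj₁ v<nn with <-+-split n n v<nn
...   | inj₁ v<n              = old v<n
...   | inj₂ (u , refl , u<n) = pendant u<n

NoIsolatedVertex : Complex → Set
NoIsolatedVertex C = ∀ {v} → v < nV C → 1 ≤ deg C v

step-noIsolatedVertex : ∀ C → WellFormed C → NoIsolatedVertex (step C)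
step-noIsolatedVertex C wf v< with stepVertex (nV C) (length (edges C)) v<
... | old v<n     = subst (1 ≤_) (sym (deg-step-old C wf v<n)) (s≤s z≤n)
... | pendant u<n = subst (1 ≤_) (sym (deg-step-pendant C wf u<n)) ≤-refl
... | apex j<m    = subst (1 ≤_) (sym (deg-step-apex C wf j<m)) (s≤s z≤n)

-- The recursion for the degree counts

data Parity : ℕ → Set where
  even : ∀ t → Parity (t * 2)
  odd  : ∀ t → Parity (suc (t * 2))

parity : ∀ k → Parity k
parity zero = even 0
parity (suc k) with parity k
... | even t = odd t
... | odd  t = even (suc t)

odd%2≡1 : ∀ t → suc (t * 2) % 2 ≡ 1
odd%2≡1 t = [m+kn]%n≡m%n 1 t 2

odd≢even : ∀ s t → suc (s * 2) ≢ t * 2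
odd≢even s t odd≡even = 1+n≢0 (begin
  1               ≡⟨ odd%2≡1 s ⟨
  suc (s * 2) % 2 ≡⟨ cong (_% 2) odd≡even ⟩
  t * 2 % 2       ≡⟨ m*n%n≡0 t 2 ⟩
  0               ∎)

oddInd-even : ∀ t → oddInd (t * 2) ≡ 0
oddInd-even t = trans (cong (λ r → indicator ((3 ≤ᵇ t * 2) ∧ (r ≡ᵇ 1))) (m*n%n≡0 t 2))
                      (cong indicator (∧-zeroʳ (3 ≤ᵇ t * 2)))

oddInd-odd : ∀ t → oddInd (suc (suc t * 2)) ≡ 1
oddInd-odd t = cong (λ r → indicator (r ≡ᵇ 1)) (odd%2≡1 (suc t))

-- The hypothesis d ≥ 1 is needed: d = 0 gives degree 1, which oddInd does not count.
δ-odd : ∀ {d} → 1 ≤ d → ∀ k → δ (suc (2 * d)) k ≡ oddInd k * δ d ((k ∸ 1) / 2)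
δ-odd {d} 1≤d k with parity k
... | even t = trans (δ-≢ (odd≢even d t ∘ trans (cong suc (*-comm d 2))))
                     (sym (cong (_* δ d ((t * 2 ∸ 1) / 2)) (oddInd-even t)))
... | odd zero = δ-≢ (λ e → <⇒≢ (≤-trans 1≤d (m≤m+n d _)) (sym (suc-injective e)))
... | odd (suc t) = begin
  δ (suc (2 * d)) (suc (suc t * 2))
    ≡⟨ δ-cong (λ e → *-cancelʳ-≡ d (suc t) 2 (trans (*-comm d 2) e)) (λ { refl → *-comm 2 d }) ⟩
  δ d (suc t)                     ≡⟨ cong (δ d) (m*n/n≡m (suc t) 2) ⟨
  δ d (suc t * 2 / 2)             ≡⟨ *-identityˡ _ ⟨
  1 * δ d (suc t * 2 / 2)         ≡⟨ cong (_* δ d (suc t * 2 / 2)) (oddInd-odd t) ⟨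
  oddInd (suc (suc t * 2)) * δ d (suc t * 2 / 2) ∎

degreeCount : Complex → ℕ → ℕ
degreeCount C k = count (λ v → deg C v ≡ᵇ k) (upTo (nV C))

degreeCount-step : ∀ C → WellFormed C → NoIsolatedVertex C → ∀ k →
  degreeCount (step C) k
    ≡ nV C * δ k 1 + length (edges C) * δ k 2 + oddInd k * degreeCount C ((k ∸ 1) / 2)
degreeCount-step C wf noIsolated k = begin
  degreeCount (step C) k
    ≡⟨ count-upTo _ (n + n + m) ⟩
  sumBelow (n + n + m) f
    ≡⟨ sumBelow-+ (n + n) m f ⟩
  sumBelow (n + n) f + sumBelow m (λ j → f (n + n + j))
    ≡⟨ cong (_+ sumBelow m (λ j → f (n + n + j))) (sumBelow-+ n n f) ⟩
  sumBelow n f + sumBelow n (λ u → f (n + u)) + sumBelow m (λ j → f (n + n + j))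
    ≡⟨ cong₂ _+_ (cong₂ _+_ olds pendants) apices ⟩
  oddInd k * sumBelow n g + n * δ k 1 + m * δ k 2
    ≡⟨ rotate (oddInd k * sumBelow n g) (n * δ k 1) (m * δ k 2) ⟩
  n * δ k 1 + m * δ k 2 + oddInd k * sumBelow n g
    ≡⟨ cong (λ x → n * δ k 1 + m * δ k 2 + oddInd k * x) (count-upTo _ n) ⟨
  n * δ k 1 + m * δ k 2 + oddInd k * degreeCount C ((k ∸ 1) / 2) ∎
  where
  n = nV C
  m = length (edges C)
  f g : ℕ → ℕ
  f v = δ (deg (step C) v) k
  g v = δ (deg C v) ((k ∸ 1) / 2)
  olds : sumBelow n f ≡ oddInd k * sumBelow n g
  olds = trans (sumBelow-cong n (λ v<n → trans (cong (λ d → δ d k) (deg-step-old C wf v<n))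
                                                (δ-odd (noIsolated v<n) k)))
               (sumBelow-*ˡ n (oddInd k) g)
  pendants : sumBelow n (λ u → f (n + u)) ≡ n * δ k 1
  pendants = trans (sumBelow-cong n (λ u<n → trans (cong (λ d → δ d k) (deg-step-pendant C wf u<n))
                                                    (δ-sym 1 k)))
                   (sumBelow-const n (δ k 1))
  apices : sumBelow m (λ j → f (n + n + j)) ≡ m * δ k 2
  apices = trans (sumBelow-cong m (λ j<m → trans (cong (λ d → δ d k) (deg-step-apex C wf j<m))
                                                  (δ-sym 2 k)))
                 (sumBelow-const m (δ k 2))
  rotate : ∀ a b c → a + b + c ≡ b + c + a
  rotate = solve-∀

-- The degree sets

kseq-odd : ∀ t → kseq (suc (t * 2)) ≡ 2 ^ suc t ∸ 1
kseq-odd t = cong₂ (λ r e → if r ≡ᵇ 1 then 2 ^ e ∸ 1 else 3 * 2 ^ (suc (t * 2) / 2 ∸ 1) ∸ 1)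
                   (odd%2≡1 t) (trans (cong (_/ 2) (+-comm (suc (t * 2)) 1)) (m*n/n≡m (suc t) 2))

kseq-even : ∀ t → kseq (suc t * 2) ≡ 3 * 2 ^ t ∸ 1
kseq-even t = cong₂ (λ r e → if r ≡ᵇ 1 then 2 ^ ((suc t * 2 + 1) / 2) ∸ 1 else 3 * 2 ^ (e ∸ 1) ∸ 1)
                    (m*n%n≡0 (suc t) 2) (m*n/n≡m (suc t) 2)

suc-2*-pred : ∀ {x} → 1 ≤ x → suc (2 * (x ∸ 1)) ≡ 2 * x ∸ 1
suc-2*-pred {suc x} _ = sym (cong (_∸ 1) (*-suc 2 x))

kseq-step : ∀ {i} → 1 ≤ i → kseq (suc (suc i)) ≡ suc (2 * kseq i)
kseq-step {i} 1≤i with parity i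
... | even zero    = ⊥-elim (n≮0 1≤i)
... | even (suc t) = begin
  kseq (suc (suc t) * 2)     ≡⟨ kseq-even (suc t) ⟩
  3 * (2 * 2 ^ t) ∸ 1        ≡⟨ cong (_∸ 1) (swap (2 ^ t)) ⟩
  2 * (3 * 2 ^ t) ∸ 1        ≡⟨ suc-2*-pred (≤-trans (m^n>0 2 t) (m≤m+n _ _)) ⟨
  suc (2 * (3 * 2 ^ t ∸ 1))  ≡⟨ cong (suc ∘ (2 *_)) (kseq-even t) ⟨
  suc (2 * kseq (suc t * 2)) ∎
  where
  swap : ∀ p → 3 * (2 * p) ≡ 2 * (3 * p)
  swap = solve-∀
... | odd t = begin
  kseq (suc (suc t * 2))       ≡⟨ kseq-odd (suc t) ⟩
  2 * 2 ^ suc t ∸ 1            ≡⟨ suc-2*-pred (m^n>0 2 (suc t)) ⟨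
  suc (2 * (2 ^ suc t ∸ 1))    ≡⟨ cong (suc ∘ (2 *_)) (kseq-odd t) ⟨
  suc (2 * kseq (suc (t * 2))) ∎

kseq-<-suc : ∀ {i} → 1 ≤ i → kseq i < kseq (suc i)
kseq-<-suc {1} _ = ≤-refl
kseq-<-suc {2} _ = ≤-refl
kseq-<-suc {suc (suc (suc i))} _ =
  subst₂ _<_ (sym (kseq-step {suc i} (s≤s z≤n))) (sym (kseq-step {suc (suc i)} (s≤s z≤n)))
         (s<s (*-monoʳ-< 2 (kseq-<-suc {suc i} (s≤s z≤n))))

N0-positive : ∀ n → 0 < N0 n
N0-positive zero    = s≤s z≤n
N0-positive (suc n) = <-≤-trans (N0-positive n) (≤-trans (m≤m+n (N0 n) _) (m≤m+n _ (N1 n)))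

nV≤edges-step : ∀ C → nV C ≤ length (edges (step C))
nV≤edges-step C =
  subst (n ≤_) (sym (length-++ (edges C)))
        (≤-trans (subst (n ≤_) (sym (length-++ pendantEdges)) (≤-trans n≤pendants (m≤m+n _ _)))
                 (m≤n+m _ _))
  where
  n = nV C
  pendantEdges = map (λ u → (u , n + u)) (upTo n)
  n≤pendants : n ≤ length pendantEdges
  n≤pendants = ≤-reflexive (sym (trans (length-map _ (upTo n)) (length-upTo n)))

N1-positive : ∀ n → 0 < N1 (suc n)
N1-positive n = <-≤-trans (N0-positive n) (nV≤edges-step (K n))

degree-in-kseq : ∀ n {v} → v < N0 (suc n) →
                 Σ ℕ λ i → 1 ≤ i × i ≤ suc (2 * n) × kseq i ≡ deg (K (suc n)) v
degree-in-kseq zero {0} _ = 1 , ≤-refl , ≤-refl , refl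
degree-in-kseq zero {1} _ = 1 , ≤-refl , ≤-refl , refl
degree-in-kseq zero {suc (suc v)} (s≤s (s≤s ()))
degree-in-kseq (suc n) v< with stepVertex (N0 (suc n)) (N1 (suc n)) v<
... | pendant u<n = 1 , ≤-refl , s≤s z≤n , sym (deg-step-pendant C wf u<n)
  where C = K (suc n) ; wf = K-wellFormed (suc n)
... | apex j<m    = 2 , s≤s z≤n , s≤s (s≤s z≤n) , sym (deg-step-apex C wf j<m)
  where C = K (suc n) ; wf = K-wellFormed (suc n)
... | old v<n with degree-in-kseq n v<n
...   | i , 1≤i , i≤ , kᵢ≡d =
  suc (suc i) , s≤s z≤n , subst (suc (suc i) ≤_) (cong suc (sym (*-suc 2 n))) (s≤s (s≤s i≤)) ,
  trans (kseq-step 1≤i) (trans (cong (suc ∘ (2 *_)) kᵢ≡d) (sym (deg-step-old C wf v<n)))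
  where C = K (suc n) ; wf = K-wellFormed (suc n)

kseq-is-degree : ∀ n {i} → 1 ≤ i → i ≤ suc (2 * n) →
                 Σ ℕ λ v → v < N0 (suc n) × deg (K (suc n)) v ≡ kseq i
kseq-is-degree zero {1} _ _ = 0 , s≤s z≤n , refl
kseq-is-degree zero {suc (suc i)} _ (s≤s ())
kseq-is-degree (suc n) {1} _ _ =
  N + 0 , <-≤-trans (+-monoʳ-< N (N0-positive (suc n))) (m≤m+n (N + N) _) ,
  deg-step-pendant (K (suc n)) (K-wellFormed (suc n)) (N0-positive (suc n))
  where N = N0 (suc n)
kseq-is-degree (suc n) {2} _ _ =
  N + N + 0 , +-monoʳ-< (N + N) (N1-positive n) ,
  deg-step-apex (K (suc n)) (K-wellFormed (suc n)) (N1-positive n)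
  where N = N0 (suc n)
kseq-is-degree (suc n) {suc (suc (suc i))} _ i≤
  with kseq-is-degree n {suc i} (s≤s z≤n) (s≤s⁻¹ (s≤s⁻¹ (subst (suc (suc (suc i)) ≤_) (cong suc (*-suc 2 n)) i≤)))
... | v , v<N , d≡kᵢ =
  v , <-≤-trans v<N (≤-trans (m≤m+n _ _) (m≤m+n _ _)) ,
  trans (deg-step-old (K (suc n)) (K-wellFormed (suc n)) v<N)
        (trans (cong (suc ∘ (2 *_)) d≡kᵢ) (sym (kseq-step {suc i} (s≤s z≤n))))

mainTheorem11 : ((n : ℕ) → 2 ≤ n → (k : ℕ) → 1 ≤ k →
    D0 k n ≡ N0 (n ∸ 1) * δ k 1 + N1 (n ∸ 1) * δ k 2 + oddInd k * D0 ((k ∸ 1) / 2) (n ∸ 1))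
    × ((n : ℕ) → 1 ≤ n →
    ((i : ℕ) → 1 ≤ i → i < 2 * n ∸ 1 → kseq i < kseq (i + 1))
    × ((k : ℕ) →
    ((Σ ℕ λ v → v < N0 n × deg (K n) v ≡ k) → Σ ℕ λ i → 1 ≤ i × i ≤ 2 * n ∸ 1 × kseq i ≡ k)
    × ((Σ ℕ λ i → 1 ≤ i × i ≤ 2 * n ∸ 1 × kseq i ≡ k) → Σ ℕ λ v → v < N0 n × deg (K n) v ≡ k)))
mainTheorem11 = recursion , degreeSets
  where
  recursion : (n : ℕ) → 2 ≤ n → (k : ℕ) → 1 ≤ k →
    D0 k n ≡ N0 (n ∸ 1) * δ k 1 + N1 (n ∸ 1) * δ k 2 + oddInd k * D0 ((k ∸ 1) / 2) (n ∸ 1)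
  recursion (suc zero) (s≤s ())
  recursion (suc (suc n)) _ k _ =
    degreeCount-step (K (suc n)) (K-wellFormed (suc n)) (step-noIsolatedVertex (K n) (K-wellFormed n)) k

  degreeSets : (n : ℕ) → 1 ≤ n →
    ((i : ℕ) → 1 ≤ i → i < 2 * n ∸ 1 → kseq i < kseq (i + 1))
    × ((k : ℕ) →
    ((Σ ℕ λ v → v < N0 n × deg (K n) v ≡ k) → Σ ℕ λ i → 1 ≤ i × i ≤ 2 * n ∸ 1 × kseq i ≡ k)
    × ((Σ ℕ λ i → 1 ≤ i × i ≤ 2 * n ∸ 1 × kseq i ≡ k) → Σ ℕ λ v → v < N0 n × deg (K n) v ≡ k))
  degreeSets (suc n) _ =
    (λ i 1≤i _ → subst (λ j → kseq i < kseq j) (+-comm 1 i) (kseq-<-suc 1≤i)) ,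
    λ k → (λ { (v , v< , d≡k) →
                 let (i , 1≤i , i≤ , kᵢ≡d) = degree-in-kseq n v<
                 in  i , 1≤i , subst (i ≤_) bound i≤ , trans kᵢ≡d d≡k })
        , (λ { (i , 1≤i , i≤ , kᵢ≡k) →
                 let (v , v< , d≡kᵢ) = kseq-is-degree n 1≤i (subst (i ≤_) (sym bound) i≤)
                 in  v , v< , trans d≡kᵢ kᵢ≡k })
    where
    bound : suc (2 * n) ≡ 2 * suc n ∸ 1
    bound = cong (_∸ 1) (sym (*-suc 2 n))
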